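{- Let $a,b$ be positive integers and let $\Delta\in\mathrm{CONF}(a,b)$ have characteristic sequence $\{x_0,\dots,x_{b-1}\}$. Let $s=\min_i x_i$ and $x'_j=x_j-s$. Then $\{x'_0,\dots,x'_{b-1}\}$ characterizes a configuration $\Delta'\in\mathrm{CONF}(a-sb,b)$, and $|\mathrm{Rot}(\Delta)|=|\mathrm{Rot}(\Delta')|$.
   Context: $\mathrm{CONF}(a,b)$ is the set of necklaces (circular arrangements up to rotation) of $a$ red and $b$ black beads. A sequence $\{x_0,\dots,x_{b-1}\}$ of nonnegative integers with sum $a$ characterizes the necklace in which black beads $B_0,\dots,B_{b-1}$ appear in cyclic order with $x_i$ red beads between $B_i$ and $B_{i+1}$ (indices mod $b$). This sequence is the characteristic sequence of that necklace and is defined up to cyclic shift. For a necklace $\Delta$ with $n$ beads, label the beads consecutively $0,\dots,n-1$ around the circle and let $t_i$ be bead $i$. $\mathrm{Rot}(\Delta)$ is the group of rotations $\phi_k(i)=i+k \bmod n$, $k\in[0,n-1]$, such that $t_i$ and $t_{\phi_k(i)}$ have the same color for all $i$. Its size is independent of the labelling. -}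

module Defs where

open import Data.Bool using (Bool; true; false)
open import Data.Nat using (ℕ; zero; suc; _+_; _*_; _∸_; _⊓_; NonZero)
open import Data.Nat.DivMod using (_mod_)
open import Data.Fin using (Fin; toℕ)
open import Data.Fin.Properties using (all?)
open import Data.List using (List; []; _∷_; _++_; replicate; length; filter; map; foldr)
open import Data.List.Base using (lookup)
open import Data.List.Relation.Unary.All using (All)
open import Data.Vec using (Vec; toList)
open import Data.Vec.Functional using ()
open import Data.Bool.Properties using (_≟_)
open import Relation.Binary.PropositionalEquality using (_≡_)
open import Relation.Nullary using (Dec)
open import Data.List using (allFin)

-- Colours: true = black bead, false = red bead.
-- A bead string (a representative of a necklace, labelled 0..n-1) is a List Bool.

-- The necklace characterized by the characteristic sequence x_0,...,x_{b-1}: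
-- B_0 R^{x_0} B_1 R^{x_1} ... B_{b-1} R^{x_{b-1}} (read cyclically).
beadsOf : List ℕ → List Bool
beadsOf [] = []
beadsOf (x ∷ xs) = true ∷ replicate x false ++ beadsOf xs

bead : (t : List Bool) → Fin (length t) → Bool
bead t i = lookup t i

shift : (n : ℕ) → .{{NonZero n}} → ℕ → Fin n → Fin n
shift n k i = Data.Nat.DivMod._mod_ (toℕ i + k) n

IsRot : (t : List Bool) → .{{NonZero (length t)}} → Fin (length t) → Set
IsRot t k = (i : Fin (length t)) → bead t i ≡ bead t (shift (length t) (toℕ k) i)

isRot? : (t : List Bool) → .{{_ : NonZero (length t)}} → (k : Fin (length t)) → Dec (IsRot t k)
isRot? t k = all? (λ i → bead t i ≟ bead t (shift (length t) (toℕ k) i))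

-- |Rot(t)|: the number of k ∈ [0, n-1] with phi_k colour-preserving
-- (for the empty string, which never arises here since b ≥ 1, we set it to 0)
rotCount : List Bool → ℕ
rotCount [] = 0
rotCount t@(_ ∷ _) = length (filter (isRot? t) (allFin (length t)))

sumL : List ℕ → ℕ
sumL = foldr _+_ 0

countTrue countFalse : List Bool → ℕ
countTrue t = length (filter (_≟ true) t)
countFalse t = length (filter (_≟ false) t)

-- minimum of a list (the empty case, never used since b ≥ 1, is set to 0)
minL : List ℕ → ℕ
minL [] = 0
minL (x ∷ xs) = foldr _⊓_ x xs

reduce : List ℕ → List ℕ
reduce x = map (λ xj → xj ∸ minL x) x

module Submission where

-- The
-- symmetry part rests on a comparison between rotations of the bead string
-- beadsOf x and rotations of the sequence x itself:
--   * a colour-preserving rotation φ_k of a string t is the same thing as a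
--     list rotation with  rotate k t ≡ t  (fixes⇔isRot), so |Rot(t)| counts
--     the offsets k < |t| fixed by rotate (rotCount-fixes);
--   * a rotation of beadsOf x fixing it must move a black bead onto the first
--     (black) bead, i.e. start at a block boundary, and rotating beadsOf x to
--     the j-th block boundary is beadsOf (rotate j x); since beadsOf is
--     injective, |Rot(beadsOf x)| counts the offsets j < |x| with
--     rotate j x ≡ x (rotCount-beadsOf).
-- The latter count is unchanged under any map that can be undone on x, such as
-- subtracting s from entries that are all at least s (rotCount-invertible-map).

open import Defs
open import Data.Bool using (Bool; true; false)
import Data.Bool.Properties as Bool
open import Data.Nat using (ℕ; zero; suc; _+_; _*_; _∸_; _⊓_; _≤_; _<_; z≤n; s≤s; NonZero)
open import Data.Nat.Properties
open import Data.Nat.DivMod using (_%_; m<n⇒m%n≡m; [m+n]%n≡m%n)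
open import Data.Fin using (Fin; toℕ)
open import Data.Fin.Properties using (toℕ<n; toℕ-fromℕ<)
open import Data.List using (List; []; _∷_; [_]; _++_; replicate; length; filter; map; foldr; drop; take; tabulate; allFin)
open import Data.List.Base using (lookup)
open import Data.List.Properties
  using (length-++; length-++-comm; length-map; length-replicate; length-drop; length-take;
         drop-map; take-map; map-++; ++-assoc; filter-++; filter-≐; tabulate-cong;
         map-tabulate; ≡-dec)
open import Data.List.Relation.Unary.All as All using (All; []; _∷_)
open import Data.Maybe using (Maybe; just; nothing)
open import Data.Maybe.Properties using (just-injective)
open import Data.Product using (_×_; _,_; proj₂; map₁; uncurry)
open import Data.Vec using (Vec; toList)
open import Data.Vec.Properties using (length-toList)
open import Function using (_∘_; _⇔_; mk⇔; Equivalence)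
open import Relation.Binary.Definitions using (DecidableEquality)
open import Relation.Binary.PropositionalEquality hiding ([_])
open import Relation.Nullary using (¬_; yes; no; does; contradiction)
open import Relation.Unary using (Decidable)
import Algebra.Properties.CommutativeSemigroup +-commutativeSemigroup as +-CSemigroup

open Equivalence using (to; from)

private
  variable
    A B : Set

count : {P : A → Set} → Decidable P → List A → ℕ
count P? xs = length (filter P? xs)

count-++ : {P : A → Set} (P? : Decidable P) (xs ys : List A) →
           count P? (xs ++ ys) ≡ count P? xs + count P? ys
count-++ P? xs ys = trans (cong length (filter-++ P? xs ys)) (length-++ (filter P? xs))

count-cong : {P Q : A → Set} (P? : Decidable P) (Q? : Decidable Q) →
             (∀ a → P a ⇔ Q a) → (xs : List A) → count P? xs ≡ count Q? xs
count-cong P? Q? P⇔Q xs = cong length (filter-≐ P? Q? ((λ {a} → to (P⇔Q a)) , (λ {a} → from (P⇔Q a))) xs)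

count-map : {Q : B → Set} (Q? : Decidable Q) (f : A → B) (xs : List A) →
            count Q? (map f xs) ≡ count (Q? ∘ f) xs
count-map Q? f [] = refl
count-map Q? f (x ∷ xs) with does (Q? (f x))
... | true  = cong suc (count-map Q? f xs)
... | false = count-map Q? f xs

count-∷ : {P Q : A → Set} (P? : Decidable P) (Q? : Decidable Q) (a b : A) (xs ys : List A) →
          P a ⇔ Q b → count P? xs ≡ count Q? ys → count P? (a ∷ xs) ≡ count Q? (b ∷ ys)
count-∷ P? Q? a b xs ys Pa⇔Qb eq with P? a | Q? b
... | yes _  | yes _  = cong suc eq
... | no _   | no _   = eq
... | yes pa | no ¬qb = contradiction (to Pa⇔Qb pa) ¬qb
... | no ¬pa | yes qb = contradiction (from Pa⇔Qb qb) ¬pa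

count-none : {P : A → Set} (P? : Decidable P) {xs : List A} → All (¬_ ∘ P) xs → count P? xs ≡ 0
count-none P? [] = refl
count-none P? {x ∷ xs} (¬px ∷ ¬pxs) with P? x
... | yes px = contradiction px ¬px
... | no _   = count-none P? ¬pxs

interval : ℕ → ℕ → List ℕ
interval m zero    = []
interval m (suc n) = m ∷ interval (suc m) n

interval-++ : ∀ m a b → interval m (a + b) ≡ interval m a ++ interval (m + a) b
interval-++ m zero    b = cong (λ p → interval p b) (sym (+-identityʳ m))
interval-++ m (suc a) b = cong (m ∷_) (trans (interval-++ (suc m) a b) (cong (λ p → interval (suc m) a ++ interval p b) (sym (+-suc m a))))

all-interval : {P : ℕ → Set} → ∀ m n → (∀ i → i < n → P (m + i)) → All P (interval m n)
all-interval         m zero    h = []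
all-interval {P = P} m (suc n) h =
  subst P (+-identityʳ m) (h 0 (s≤s z≤n)) ∷
  all-interval (suc m) n (λ i i<n → subst P (+-suc m i) (h (suc i) (s≤s i<n)))

tabulate-interval : ∀ n m → tabulate {n = n} (λ i → m + toℕ i) ≡ interval m n
tabulate-interval zero    m = refl
tabulate-interval (suc n) m =
  cong₂ _∷_ (+-identityʳ m) (trans (tabulate-cong (λ i → +-suc m (toℕ i))) (tabulate-interval n (suc m)))

allFin-interval : ∀ n → map toℕ (allFin n) ≡ interval 0 n
allFin-interval n = trans (map-tabulate (λ i → i) toℕ) (tabulate-interval n 0)

_‼_ : List A → ℕ → Maybe A
[]       ‼ i     = nothing
(x ∷ xs) ‼ zero  = just x
(x ∷ xs) ‼ suc i = xs ‼ i

‼-lookup : (xs : List A) (i : Fin (length xs)) → xs ‼ toℕ i ≡ just (lookup xs i)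
‼-lookup (x ∷ xs) Fin.zero    = refl
‼-lookup (x ∷ xs) (Fin.suc i) = ‼-lookup xs i

‼-++ˡ : (xs : List A) {ys : List A} {i : ℕ} → i < length xs → (xs ++ ys) ‼ i ≡ xs ‼ i
‼-++ˡ (x ∷ xs) {i = zero}  _         = refl
‼-++ˡ (x ∷ xs) {i = suc i} (s≤s i<n) = ‼-++ˡ xs i<n

‼-++ʳ : (xs : List A) {ys : List A} (j : ℕ) → (xs ++ ys) ‼ (length xs + j) ≡ ys ‼ j
‼-++ʳ []       j = refl
‼-++ʳ (x ∷ xs) j = ‼-++ʳ xs j

‼-drop : (k : ℕ) (xs : List A) (i : ℕ) → drop k xs ‼ i ≡ xs ‼ (k + i)
‼-drop zero    xs       i = refl
‼-drop (suc k) []       i = refl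
‼-drop (suc k) (x ∷ xs) i = ‼-drop k xs i

‼-take : (k : ℕ) (xs : List A) {i : ℕ} → i < k → take k xs ‼ i ≡ xs ‼ i
‼-take (suc k) []       _         = refl
‼-take (suc k) (x ∷ xs) {zero}  _ = refl
‼-take (suc k) (x ∷ xs) {suc i} (s≤s i<k) = ‼-take k xs i<k

‼-replicate : (n : ℕ) {c : A} {i : ℕ} → i < n → replicate n c ‼ i ≡ just c
‼-replicate (suc n) {i = zero}  _         = refl
‼-replicate (suc n) {i = suc i} (s≤s i<n) = ‼-replicate n i<n

‼-ext : (xs ys : List A) → length xs ≡ length ys →
        ((i : Fin (length ys)) → xs ‼ toℕ i ≡ ys ‼ toℕ i) → xs ≡ ys
‼-ext []       []       _     _    = refl
‼-ext (x ∷ xs) (y ∷ ys) |xs|≡ same =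
  cong₂ _∷_ (just-injective (same Fin.zero)) (‼-ext xs ys (suc-injective |xs|≡) (same ∘ Fin.suc))

rotate : ℕ → List A → List A
rotate k xs = drop k xs ++ take k xs

length-rotate : (k : ℕ) (xs : List A) → k ≤ length xs → length (rotate k xs) ≡ length xs
length-rotate k xs k≤n = begin
  length (drop k xs ++ take k xs)        ≡⟨ length-++ (drop k xs) ⟩
  length (drop k xs) + length (take k xs) ≡⟨ cong₂ _+_ (length-drop k xs) (length-take k xs) ⟩
  (length xs ∸ k) + (k ⊓ length xs)      ≡⟨ cong (length xs ∸ k +_) (m≤n⇒m⊓n≡m k≤n) ⟩
  (length xs ∸ k) + k                    ≡⟨ m∸n+n≡m k≤n ⟩
  length xs                              ∎
  where open ≡-Reasoning

rotate-‼ : (k : ℕ) (xs : List A) .{{_ : NonZero (length xs)}} {i : ℕ} →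
           k ≤ length xs → i < length xs → rotate k xs ‼ i ≡ xs ‼ ((i + k) % length xs)
rotate-‼ k xs {i} k≤n i<n with i <? length xs ∸ k
... | yes i<n∸k = begin
  rotate k xs ‼ i            ≡⟨ ‼-++ˡ (drop k xs) (subst (i <_) (sym (length-drop k xs)) i<n∸k) ⟩
  drop k xs ‼ i              ≡⟨ ‼-drop k xs i ⟩
  xs ‼ (k + i)               ≡⟨ cong (xs ‼_) (trans (+-comm k i) (sym (m<n⇒m%n≡m i+k<n))) ⟩
  xs ‼ ((i + k) % length xs) ∎
  where
    open ≡-Reasoning
    i+k<n : i + k < length xs
    i+k<n = subst (i + k <_) (m∸n+n≡m k≤n) (+-monoˡ-< k i<n∸k)
... | no i≮n∸k = begin
  rotate k xs ‼ i                        ≡⟨ cong (rotate k xs ‼_) (sym i≡) ⟩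
  rotate k xs ‼ (length (drop k xs) + j) ≡⟨ ‼-++ʳ (drop k xs) j ⟩
  take k xs ‼ j                          ≡⟨ ‼-take k xs j<k ⟩
  xs ‼ j                                 ≡⟨ cong (xs ‼_) (sym i+k%n≡j) ⟩
  xs ‼ ((i + k) % length xs)             ∎
  where
    open ≡-Reasoning
    -- i lies in the wrapped-around part: i = (n ∸ k) + j with j < k
    d j : ℕ
    d = length xs ∸ k
    j = i ∸ d
    d+j≡i : d + j ≡ i
    d+j≡i = m+[n∸m]≡n (≮⇒≥ i≮n∸k)
    i≡ : length (drop k xs) + j ≡ i
    i≡ = trans (cong (_+ j) (length-drop k xs)) d+j≡i
    d+k≡n : d + k ≡ length xs
    d+k≡n = m∸n+n≡m k≤n
    j<k : j < k
    j<k = +-cancelˡ-< d j k (subst₂ _<_ (sym d+j≡i) (sym d+k≡n) i<n)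
    i+k%n≡j : (i + k) % length xs ≡ j
    i+k%n≡j = begin
      (i + k) % length xs            ≡⟨ cong (λ m → (m + k) % length xs) (sym d+j≡i) ⟩
      (d + j + k) % length xs        ≡⟨ cong (_% length xs) (trans (cong (_+ k) (+-comm d j)) (+-assoc j d k)) ⟩
      (j + (d + k)) % length xs      ≡⟨ cong (λ m → (j + m) % length xs) d+k≡n ⟩
      (j + length xs) % length xs    ≡⟨ [m+n]%n≡m%n j (length xs) ⟩
      j % length xs                  ≡⟨ m<n⇒m%n≡m (<-≤-trans j<k k≤n) ⟩
      j                              ∎

rotate-‼-front : (k : ℕ) (xs : List A) {c : A} → xs ‼ k ≡ just c → rotate k xs ‼ 0 ≡ just c
rotate-‼-front k xs eq = front (drop k xs) (trans (‼-drop k xs 0) (trans (cong (xs ‼_) (+-identityʳ k)) eq))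
  where
    front : ∀ {c} (ys : List _) {zs} → ys ‼ 0 ≡ just c → (ys ++ zs) ‼ 0 ≡ just c
    front (y ∷ ys) eq = eq

rotate-++ : (xs ys : List A) → rotate (length xs) (xs ++ ys) ≡ ys ++ xs
rotate-++ xs ys = cong₂ _++_ (drop-prefix xs) (take-prefix xs)
  where
    drop-prefix : (xs : List _) → drop (length xs) (xs ++ ys) ≡ ys
    drop-prefix []       = refl
    drop-prefix (x ∷ xs) = drop-prefix xs
    take-prefix : (xs : List _) → take (length xs) (xs ++ ys) ≡ xs
    take-prefix []       = refl
    take-prefix (x ∷ xs) = cong (x ∷_) (take-prefix xs)

rotate-map : (f : A → B) (k : ℕ) (xs : List A) → rotate k (map f xs) ≡ map f (rotate k xs)
rotate-map f k xs = trans (cong₂ _++_ (drop-map k xs) (take-map k xs)) (sym (map-++ f (drop k xs) (take k xs)))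

Fixes : List A → ℕ → Set
Fixes xs k = rotate k xs ≡ xs

fixes? : DecidableEquality A → (xs : List A) → Decidable (Fixes xs)
fixes? _≟ᴬ_ xs k = ≡-dec _≟ᴬ_ (rotate k xs) xs

no-fix : {xs : List A} {k : ℕ} {a b : A} → xs ‼ 0 ≡ just a → xs ‼ k ≡ just b → a ≢ b → ¬ Fixes xs k
no-fix {xs = xs} {k} xs₀≡a xsₖ≡b a≢b fix =
  a≢b (just-injective (trans (sym xs₀≡a) (trans (cong (_‼ 0) (sym fix)) (rotate-‼-front k xs xsₖ≡b))))

fixes-invertible-map : (f : A → B) (g : B → A) {xs : List A} → map g (map f xs) ≡ xs →
                       (k : ℕ) → Fixes xs k ⇔ Fixes (map f xs) k
fixes-invertible-map f g {xs} g∘f≡id k = mk⇔ forth back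
  where
    open ≡-Reasoning
    forth : Fixes xs k → Fixes (map f xs) k
    forth fix = trans (rotate-map f k xs) (cong (map f) fix)
    back : Fixes (map f xs) k → Fixes xs k
    back fix = begin
      rotate k xs                     ≡⟨ cong (rotate k) (sym g∘f≡id) ⟩
      rotate k (map g (map f xs))     ≡⟨ rotate-map g k (map f xs) ⟩
      map g (rotate k (map f xs))     ≡⟨ cong (map g) fix ⟩
      map g (map f xs)                ≡⟨ g∘f≡id ⟩
      xs                              ∎

fixes⇔isRot : (t : List Bool) .{{_ : NonZero (length t)}} (k : Fin (length t)) →
              Fixes t (toℕ k) ⇔ IsRot t k
fixes⇔isRot t k = mk⇔ forth back
  where
    open ≡-Reasoning
    n : ℕ
    n = length t
    k≤n : toℕ k ≤ n
    k≤n = <⇒≤ (toℕ<n k)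
    shifted : (i : Fin n) → t ‼ ((toℕ i + toℕ k) % n) ≡ just (bead t (shift n (toℕ k) i))
    shifted i = trans (cong (t ‼_) (sym (toℕ-fromℕ< _))) (‼-lookup t (shift n (toℕ k) i))
    forth : Fixes t (toℕ k) → IsRot t k
    forth fix i = just-injective (begin
      just (bead t i)                       ≡⟨ ‼-lookup t i ⟨
      t ‼ toℕ i                             ≡⟨ cong (_‼ toℕ i) fix ⟨
      rotate (toℕ k) t ‼ toℕ i              ≡⟨ rotate-‼ (toℕ k) t k≤n (toℕ<n i) ⟩
      t ‼ ((toℕ i + toℕ k) % n)             ≡⟨ shifted i ⟩
      just (bead t (shift n (toℕ k) i))     ∎)
    back : IsRot t k → Fixes t (toℕ k)
    back isRot = ‼-ext (rotate (toℕ k) t) t (length-rotate (toℕ k) t k≤n) λ i → begin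
      rotate (toℕ k) t ‼ toℕ i              ≡⟨ rotate-‼ (toℕ k) t k≤n (toℕ<n i) ⟩
      t ‼ ((toℕ i + toℕ k) % n)             ≡⟨ shifted i ⟩
      just (bead t (shift n (toℕ k) i))     ≡⟨ cong just (isRot i) ⟨
      just (bead t i)                       ≡⟨ ‼-lookup t i ⟨
      t ‼ toℕ i                             ∎

rotCount-fixes : (c : Bool) (r : List Bool) →
                 rotCount (c ∷ r) ≡ count (fixes? Bool._≟_ (c ∷ r)) (interval 0 (length (c ∷ r)))
rotCount-fixes c r = begin
  count (isRot? t) (allFin n)                  ≡⟨ count-cong (isRot? t) (fixes? Bool._≟_ t ∘ toℕ) isRot⇔fixes (allFin n) ⟩
  count (fixes? Bool._≟_ t ∘ toℕ) (allFin n)   ≡⟨ count-map (fixes? Bool._≟_ t) toℕ (allFin n) ⟨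
  count (fixes? Bool._≟_ t) (map toℕ (allFin n)) ≡⟨ cong (count (fixes? Bool._≟_ t)) (allFin-interval n) ⟩
  count (fixes? Bool._≟_ t) (interval 0 n)     ∎
  where
    open ≡-Reasoning
    t : List Bool
    t = c ∷ r
    n : ℕ
    n = length t
    isRot⇔fixes : (k : Fin n) → IsRot t k ⇔ Fixes t (toℕ k)
    isRot⇔fixes k = mk⇔ (from (fixes⇔isRot t k)) (to (fixes⇔isRot t k))

beadsOf-++ : (xs ys : List ℕ) → beadsOf (xs ++ ys) ≡ beadsOf xs ++ beadsOf ys
beadsOf-++ []       ys = refl
beadsOf-++ (x ∷ xs) ys =
  cong (true ∷_) (trans (cong (replicate x false ++_) (beadsOf-++ xs ys))
                        (sym (++-assoc (replicate x false) (beadsOf xs) (beadsOf ys))))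

length-beadsOf-∷ : (y : ℕ) (ys : List ℕ) → length (beadsOf (y ∷ ys)) ≡ suc (y + length (beadsOf ys))
length-beadsOf-∷ y ys =
  cong suc (trans (length-++ (replicate y false)) (cong (_+ length (beadsOf ys)) (length-replicate y)))

length-beadsOf-∷ʳ : (zs : List ℕ) (y : ℕ) → length (beadsOf (zs ++ [ y ])) ≡ suc (length (beadsOf zs) + y)
length-beadsOf-∷ʳ zs y = begin
  length (beadsOf (zs ++ [ y ]))               ≡⟨ cong length (beadsOf-++ zs [ y ]) ⟩
  length (beadsOf zs ++ beadsOf [ y ])         ≡⟨ length-++ (beadsOf zs) ⟩
  length (beadsOf zs) + length (beadsOf [ y ]) ≡⟨ cong (length (beadsOf zs) +_) (length-beadsOf-∷ y []) ⟩
  length (beadsOf zs) + suc (y + 0)            ≡⟨ cong (λ m → length (beadsOf zs) + suc m) (+-identityʳ y) ⟩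
  length (beadsOf zs) + suc y                  ≡⟨ +-suc (length (beadsOf zs)) y ⟩
  suc (length (beadsOf zs) + y)                ∎
  where open ≡-Reasoning

-- Reading a bead string back: the number of leading red beads, and the
-- characteristic sequence of the remainder.  It is a left inverse of beadsOf.
readGaps : List Bool → ℕ × List ℕ
readGaps []          = 0 , []
readGaps (false ∷ t) = map₁ suc (readGaps t)
readGaps (true ∷ t)  = 0 , uncurry _∷_ (readGaps t)

readGaps-reds : (y : ℕ) (t : List Bool) → readGaps (replicate y false ++ t) ≡ map₁ (y +_) (readGaps t)
readGaps-reds zero    t = refl
readGaps-reds (suc y) t = cong (map₁ suc) (readGaps-reds y t)

readGaps-beadsOf : (xs : List ℕ) → readGaps (beadsOf xs) ≡ (0 , xs)
readGaps-beadsOf []       = refl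
readGaps-beadsOf (y ∷ xs) =
  trans (cong (λ p → 0 , uncurry _∷_ p) (trans (readGaps-reds y (beadsOf xs)) (cong (map₁ (y +_)) (readGaps-beadsOf xs))))
        (cong (λ m → 0 , m ∷ xs) (+-identityʳ y))

beadsOf-injective : {xs ys : List ℕ} → beadsOf xs ≡ beadsOf ys → xs ≡ ys
beadsOf-injective {xs} {ys} eq =
  cong proj₂ (trans (sym (readGaps-beadsOf xs)) (trans (cong readGaps eq) (readGaps-beadsOf ys)))

countTrue-beadsOf : (xs : List ℕ) → countTrue (beadsOf xs) ≡ length xs
countTrue-beadsOf []       = refl
countTrue-beadsOf (y ∷ xs) = cong suc (trans (no-black y) (countTrue-beadsOf xs))
  where
    no-black : ∀ y → countTrue (replicate y false ++ beadsOf xs) ≡ countTrue (beadsOf xs)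
    no-black zero    = refl
    no-black (suc y) = no-black y

countFalse-beadsOf : (xs : List ℕ) → countFalse (beadsOf xs) ≡ sumL xs
countFalse-beadsOf []       = refl
countFalse-beadsOf (y ∷ xs) = trans (reds y) (cong (y +_) (countFalse-beadsOf xs))
  where
    reds : ∀ y → countFalse (replicate y false ++ beadsOf xs) ≡ y + countFalse (beadsOf xs)
    reds zero    = refl
    reds (suc y) = cong suc (reds y)

fixes-at-black : (zs ys : List ℕ) →
                 Fixes (beadsOf (zs ++ ys)) (length (beadsOf zs)) ⇔ Fixes (zs ++ ys) (length zs)
fixes-at-black zs ys = mk⇔ forth back
  where
    rotated : rotate (length (beadsOf zs)) (beadsOf (zs ++ ys)) ≡ beadsOf (ys ++ zs)
    rotated = trans (cong (rotate (length (beadsOf zs))) (beadsOf-++ zs ys))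
                    (trans (rotate-++ (beadsOf zs) (beadsOf ys)) (sym (beadsOf-++ ys zs)))
    forth : Fixes (beadsOf (zs ++ ys)) (length (beadsOf zs)) → Fixes (zs ++ ys) (length zs)
    forth fix = trans (rotate-++ zs ys) (beadsOf-injective (trans (sym rotated) fix))
    back : Fixes (zs ++ ys) (length zs) → Fixes (beadsOf (zs ++ ys)) (length (beadsOf zs))
    back fix = trans rotated (cong beadsOf (trans (sym (rotate-++ zs ys)) fix))

-- Rotating to a red bead never fixes a bead string, which starts with a black bead.
no-fix-at-red : (zs : List ℕ) (y : ℕ) (ys : List ℕ) (i : ℕ) → i < y →
                ¬ Fixes (beadsOf (zs ++ y ∷ ys)) (suc (length (beadsOf zs)) + i)
no-fix-at-red zs y ys i i<y = no-fix (first-black zs) red (λ ())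
  where
    first-black : (zs : List ℕ) → beadsOf (zs ++ y ∷ ys) ‼ 0 ≡ just true
    first-black []      = refl
    first-black (_ ∷ _) = refl
    red : beadsOf (zs ++ y ∷ ys) ‼ (suc (length (beadsOf zs)) + i) ≡ just false
    red = begin
      beadsOf (zs ++ y ∷ ys) ‼ (suc (length (beadsOf zs)) + i)
        ≡⟨ cong₂ _‼_ (beadsOf-++ zs (y ∷ ys)) (sym (+-suc (length (beadsOf zs)) i)) ⟩
      (beadsOf zs ++ beadsOf (y ∷ ys)) ‼ (length (beadsOf zs) + suc i)
        ≡⟨ ‼-++ʳ (beadsOf zs) (suc i) ⟩
      (replicate y false ++ beadsOf ys) ‼ i
        ≡⟨ ‼-++ˡ (replicate y false) (subst (i <_) (sym (length-replicate y)) i<y) ⟩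
      replicate y false ‼ i
        ≡⟨ ‼-replicate y i<y ⟩
      just false ∎
      where open ≡-Reasoning

positions-block : (zs : List ℕ) (y : ℕ) (ys : List ℕ) →
  interval (length (beadsOf zs)) (length (beadsOf (y ∷ ys)))
  ≡ length (beadsOf zs) ∷ interval (suc (length (beadsOf zs))) y
                         ++ interval (length (beadsOf (zs ++ [ y ]))) (length (beadsOf ys))
positions-block zs y ys = begin
  interval m (length (beadsOf (y ∷ ys)))                      ≡⟨ cong (interval m) (length-beadsOf-∷ y ys) ⟩
  m ∷ interval (suc m) (y + L)                                ≡⟨ cong (m ∷_) (interval-++ (suc m) y L) ⟩
  m ∷ interval (suc m) y ++ interval (suc m + y) L            ≡⟨ cong (λ p → m ∷ interval (suc m) y ++ interval p L) (sym (length-beadsOf-∷ʳ zs y)) ⟩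
  m ∷ interval (suc m) y ++ interval (length (beadsOf (zs ++ [ y ]))) L ∎
  where
    open ≡-Reasoning
    m L : ℕ
    m = length (beadsOf zs)
    L = length (beadsOf ys)

count-blocks : (x zs ys : List ℕ) → zs ++ ys ≡ x →
  count (fixes? Bool._≟_ (beadsOf x)) (interval (length (beadsOf zs)) (length (beadsOf ys)))
  ≡ count (fixes? _≟_ x) (interval (length zs) (length ys))
count-blocks x zs []       _    = refl
count-blocks x zs (y ∷ ys) refl = begin
  count Fᵇ (interval m (length (beadsOf (y ∷ ys))))            ≡⟨ cong (count Fᵇ) (positions-block zs y ys) ⟩
  count Fᵇ (m ∷ interval (suc m) y ++ interval m′ L)           ≡⟨ count-∷ Fᵇ Fˣ m (length zs) _ _ (fixes-at-black zs (y ∷ ys)) rest ⟩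
  count Fˣ (length zs ∷ interval (length (zs ++ [ y ])) (length ys)) ≡⟨ cong (λ p → count Fˣ (length zs ∷ interval p (length ys))) |zs++y|≡ ⟩
  count Fˣ (interval (length zs) (length (y ∷ ys)))             ∎
  where
    open ≡-Reasoning
    Fᵇ : Decidable (Fixes (beadsOf (zs ++ y ∷ ys)))
    Fᵇ = fixes? Bool._≟_ (beadsOf (zs ++ y ∷ ys))
    Fˣ : Decidable (Fixes (zs ++ y ∷ ys))
    Fˣ = fixes? _≟_ (zs ++ y ∷ ys)
    m m′ L : ℕ
    m  = length (beadsOf zs)
    m′ = length (beadsOf (zs ++ [ y ]))
    L  = length (beadsOf ys)
    |zs++y|≡ : length (zs ++ [ y ]) ≡ suc (length zs)
    |zs++y|≡ = length-++-comm zs [ y ]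
    rest : count Fᵇ (interval (suc m) y ++ interval m′ L) ≡ count Fˣ (interval (length (zs ++ [ y ])) (length ys))
    rest = begin
      count Fᵇ (interval (suc m) y ++ interval m′ L)       ≡⟨ count-++ Fᵇ (interval (suc m) y) (interval m′ L) ⟩
      count Fᵇ (interval (suc m) y) + count Fᵇ (interval m′ L)
        ≡⟨ cong (_+ count Fᵇ (interval m′ L)) (count-none Fᵇ (all-interval (suc m) y (no-fix-at-red zs y ys))) ⟩
      count Fᵇ (interval m′ L)                             ≡⟨ count-blocks (zs ++ y ∷ ys) (zs ++ [ y ]) ys (++-assoc zs [ y ] ys) ⟩
      count Fˣ (interval (length (zs ++ [ y ])) (length ys)) ∎

rotCount-beadsOf : (x : List ℕ) → rotCount (beadsOf x) ≡ count (fixes? _≟_ x) (interval 0 (length x))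
rotCount-beadsOf []       = refl
rotCount-beadsOf (y ∷ ys) =
  trans (rotCount-fixes true (replicate y false ++ beadsOf ys)) (count-blocks (y ∷ ys) [] (y ∷ ys) refl)

rotCount-invertible-map : (f g : ℕ → ℕ) (x : List ℕ) → map g (map f x) ≡ x →
                          rotCount (beadsOf x) ≡ rotCount (beadsOf (map f x))
rotCount-invertible-map f g x g∘f≡id = begin
  rotCount (beadsOf x)                                        ≡⟨ rotCount-beadsOf x ⟩
  count (fixes? _≟_ x) (interval 0 (length x))                ≡⟨ count-cong (fixes? _≟_ x) (fixes? _≟_ (map f x)) (fixes-invertible-map f g g∘f≡id) (interval 0 (length x)) ⟩
  count (fixes? _≟_ (map f x)) (interval 0 (length x))        ≡⟨ cong (λ n → count (fixes? _≟_ (map f x)) (interval 0 n)) (length-map f x) ⟨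
  count (fixes? _≟_ (map f x)) (interval 0 (length (map f x))) ≡⟨ rotCount-beadsOf (map f x) ⟨
  rotCount (beadsOf (map f x))                                ∎
  where open ≡-Reasoning

minL-lowerBound : (xs : List ℕ) → All (minL xs ≤_) xs
minL-lowerBound []       = []
minL-lowerBound (x ∷ xs) = foldr-⊓-lowerBound x xs
  where
    foldr-⊓-lowerBound : ∀ x xs → All (foldr _⊓_ x xs ≤_) (x ∷ xs)
    foldr-⊓-lowerBound x []       = ≤-refl ∷ []
    foldr-⊓-lowerBound x (y ∷ ys) with foldr-⊓-lowerBound x ys
    ... | r≤x ∷ r≤ys = ≤-trans (m⊓n≤n y _) r≤x ∷ m⊓n≤m y _ ∷ All.map (≤-trans (m⊓n≤n y _)) r≤ys

∸-+-inverse : (s : ℕ) {xs : List ℕ} → All (s ≤_) xs → map (_+ s) (map (_∸ s) xs) ≡ xs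
∸-+-inverse s []           = refl
∸-+-inverse s (s≤x ∷ s≤xs) = cong₂ _∷_ (m∸n+n≡m s≤x) (∸-+-inverse s s≤xs)

sumL-map-+ : (s : ℕ) (xs : List ℕ) → sumL (map (_+ s) xs) ≡ sumL xs + s * length xs
sumL-map-+ s []       = sym (*-zeroʳ s)
sumL-map-+ s (x ∷ xs) = begin
  (x + s) + sumL (map (_+ s) xs)        ≡⟨ cong ((x + s) +_) (sumL-map-+ s xs) ⟩
  (x + s) + (sumL xs + s * length xs)   ≡⟨ +-CSemigroup.interchange x s (sumL xs) (s * length xs) ⟩
  (x + sumL xs) + (s + s * length xs)   ≡⟨ cong ((x + sumL xs) +_) (*-suc s (length xs)) ⟨
  (x + sumL xs) + s * suc (length xs)   ∎
  where open ≡-Reasoning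

sumL-reduce : (xs : List ℕ) → sumL (reduce xs) + minL xs * length (reduce xs) ≡ sumL xs
sumL-reduce xs = begin
  sumL (map (_∸ s) xs) + s * length (map (_∸ s) xs) ≡⟨ sumL-map-+ s (map (_∸ s) xs) ⟨
  sumL (map (_+ s) (map (_∸ s) xs))                 ≡⟨ cong sumL (∸-+-inverse s (minL-lowerBound xs)) ⟩
  sumL xs                                           ∎
  where
    open ≡-Reasoning
    s : ℕ
    s = minL xs

proposition10 : (a b : ℕ) → 0 < a → 0 < b → (x : Vec ℕ b) → sumL (toList x) ≡ a →
    (minL (toList x) * b + (a ∸ minL (toList x) * b) ≡ a)
    × (length (reduce (toList x)) ≡ b)
    × (sumL (reduce (toList x)) ≡ a ∸ minL (toList x) * b)
    × (countTrue (beadsOf (reduce (toList x))) ≡ b)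
    × (countFalse (beadsOf (reduce (toList x))) ≡ a ∸ minL (toList x) * b)
    × (rotCount (beadsOf (toList x)) ≡ rotCount (beadsOf (reduce (toList x))))
proposition10 a b _ _ x Σx≡a =
  sb+[a∸sb]≡a , |x′|≡b , Σx′≡a∸sb ,
  trans (countTrue-beadsOf x′) |x′|≡b ,
  trans (countFalse-beadsOf x′) Σx′≡a∸sb ,
  rotCount-invertible-map (_∸ s) (_+ s) l (∸-+-inverse s (minL-lowerBound l))
  where
    l x′ : List ℕ
    s : ℕ
    l  = toList x
    s  = minL l
    x′ = reduce l
    |x′|≡b : length x′ ≡ b
    |x′|≡b = trans (length-map (_∸ s) l) (length-toList x)
    a≡ : sumL x′ + s * b ≡ a
    a≡ = trans (cong (λ n → sumL x′ + s * n) (sym |x′|≡b)) (trans (sumL-reduce l) Σx≡a)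
    sb+[a∸sb]≡a : s * b + (a ∸ s * b) ≡ a
    sb+[a∸sb]≡a = m+[n∸m]≡n (subst (s * b ≤_) a≡ (m≤n+m (s * b) (sumL x′)))
    Σx′≡a∸sb : sumL x′ ≡ a ∸ s * b
    Σx′≡a∸sb = trans (sym (m+n∸n≡m (sumL x′) (s * b))) (cong (_∸ s * b) a≡)
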